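{- Let $B\ge 3$ be odd, $d=(B+1)/2$, and $r$ an integer with $1\le r<B/2$. Let $S=\{d+x: x\in\langle r\rangle\}$ where $\langle r\rangle$ is the cyclic subgroup of $\mathbb{Z}_d$ generated by $r$, and let $A(B,r)_S$ be the principal submatrix of $A(B,r)$ with rows and columns indexed by $S$. Then $G[A(B,r)_S]$ is strongly connected.
   Context: $A(B,r)$ is the $d\times d$ real matrix whose rows and columns are indexed by $\{d,d+1,\dots,B\}$, with entries (all unspecified entries are $0$): row $d$: $A_{d,d}=-d$, $A_{d,B+1-r}=2(B+1-r)$, and $A_{d,k}=k$ for $B+1-r<k\le B$; for $d<k\le d+r-1$: $A_{k,k}=-k$ and $A_{k,d+k-r}=d+k-r$; for $d+r\le k\le B$: $A_{k,k}=-k$ and $A_{k,k-r}=k-r$. For a square matrix $M$ with index set $I$, the underlying directed graph $G[M]$ has vertex set $I$ and a directed edge from $i$ to $j$ iff $M_{i,j}\ne 0$. -}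

module Defs where

open import Data.Nat using (ℕ; suc; _+_; _*_; _∸_; _≤_; _<_; _/_; _%_; _≟_; _<?_; _≤?_)
open import Data.Integer using (ℤ; +_; -_; 0ℤ)
open import Data.Bool using (Bool; if_then_else_; _∧_; _∨_; not)
open import Data.Product using (Σ; ∃-syntax; _×_; proj₁)
open import Relation.Nullary using (¬_; does)
open import Relation.Binary.PropositionalEquality using (_≡_)
open import Relation.Binary.Construct.Closure.ReflexiveTransitive using (Star)

half : ℕ → ℕ
half B = suc B / 2

-- The matrix A(B,r), entries indexed by all naturals; entries outside the
-- index set {d,...,B} are 0 (they are never used).
A : (B r : ℕ) → ℕ → ℕ → ℤ
A B r i j =
  if not inRange then 0ℤ
  else if does (i ≟ d) then
    (if does (j ≟ d) then - (+ d)
     else if does (j ≟ B + 1 ∸ r) then + (2 * (B + 1 ∸ r))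
     else if does (B + 1 ∸ r <? j) ∧ does (j ≤? B) then + j
     else 0ℤ)
  else if does (i <? d + r) then
    (if does (j ≟ i) then - (+ i)
     else if does (j ≟ d + i ∸ r) then + (d + i ∸ r)
     else 0ℤ)
  else
    (if does (j ≟ i) then - (+ i)
     else if does (j ≟ i ∸ r) then + (i ∸ r)
     else 0ℤ)
  where
  d : ℕ
  d = half B
  inRange : Bool
  inRange = does (d ≤? i) ∧ does (i ≤? B) ∧ does (d ≤? j) ∧ does (j ≤? B)

-- x lies in the cyclic subgroup ⟨r⟩ of ℤ_d (x represented by 0 ≤ x < d):
-- x ≡ m·r (mod d) for some m, i.e. m·r = q·d + x.
InCyclic : (d r x : ℕ) → Set
InCyclic d r x = x < d × ∃[ m ] ∃[ q ] (m * r ≡ q * d + x)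

InS : (B r i : ℕ) → Set
InS B r i = half B ≤ i × InCyclic (half B) r (i ∸ half B)

SIdx : (B r : ℕ) → Set
SIdx B r = Σ ℕ (InS B r)

A_S : (B r : ℕ) → SIdx B r → SIdx B r → ℤ
A_S B r i j = A B r (proj₁ i) (proj₁ j)

Edge : {I : Set} → (I → I → ℤ) → I → I → Set
Edge M i j = ¬ (M i j ≡ 0ℤ)

StronglyConnected : {I : Set} → (I → I → ℤ) → Set
StronglyConnected {I} M = (i j : I) → Star (Edge M) i j

{-# OPTIONS --safe #-}
module Submission where

open import Defs
open import Data.Nat
  using (ℕ; zero; suc; _+_; _*_; _∸_; _/_; _%_; _≤_; _<_; _≟_; _<?_; _≤?_; s≤s; s≤s⁻¹; z<s; NonZero; >-nonZero)
open import Data.Nat.Properties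
open import Data.Nat.DivMod
open import Data.Nat.Tactic.RingSolver using (solve-∀)
open import Data.Integer using (ℤ; +_; -_)
open import Data.Product using (Σ; _,_; proj₁; proj₂; ∃-syntax; _×_)
open import Data.Sum using (inj₁; inj₂)
open import Relation.Nullary using (yes; no)
open import Relation.Nullary.Decidable using (dec-true; dec-false)
open import Relation.Binary.PropositionalEquality
open import Relation.Binary.Construct.Closure.ReflexiveTransitive using (Star; ε; _◅_)

-- Write the indices as i = d + x with x ∈ ℤ_d. Each of the three kinds of rows of A(B,r)
-- (x = 0, 0 < x < r, r ≤ x) has a nonzero entry in column d + (x − r mod d), so G[A(B,r)]
-- contains the edges of the translation x ↦ x − r of ℤ_d. On S = d + ⟨r⟩ it sends d + (m+1)r to
-- d + mr, and since (a + bd)r ≡ ar (mod d), walking down from d + ar = d + (a + bd)r reaches d + br.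

module _ {I : Set} (M : I → I → ℤ) where

  edge-positive : ∀ {i j n} → M i j ≡ + n → 0 < n → Edge M i j
  edge-positive {n = suc _} Mij≡n _ Mij≡0 with () ← trans (sym Mij≡n) Mij≡0

  edge-negative : ∀ {i j n} → M i j ≡ - (+ n) → 0 < n → Edge M i j
  edge-negative {n = suc _} Mij≡-n _ Mij≡0 with () ← trans (sym Mij≡-n) Mij≡0

  -- Vertices of the restricted graph over the same i may carry different proofs of P i;
  -- the loop at i is what connects them.
  star-restrict : ∀ {P : I → Set} → (∀ {i} → P i → Edge M i i) →
                  ∀ {i j} → Star (λ k l → P l × Edge M k l) i j →
                  (u v : Σ I P) → proj₁ u ≡ i → proj₁ v ≡ j →
                  Star (Edge (λ u v → M (proj₁ u) (proj₁ v))) u v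
  star-restrict loop ε (i , _) (.i , p) refl refl = loop p ◅ ε
  star-restrict loop ((p , e) ◅ path) (i , _) v refl v≡j =
    e ◅ star-restrict loop path (_ , p) v refl v≡j

star-descending : ∀ {A : Set} {R : A → A → Set} (f : ℕ → A) → (∀ m → R (f (suc m)) (f m)) →
                  ∀ {m n} → m ≤ n → Star R (f n) (f m)
star-descending f step m≤n with m≤n⇒m<n∨m≡n m≤n
... | inj₂ refl = ε
... | inj₁ (s≤s m≤n') = step _ ◅ star-descending f step m≤n'

module _ {d : ℕ} .{{_ : NonZero d}} where

  [m%d+n]%d≡[m+n]%d : ∀ m n → (m % d + n) % d ≡ (m + n) % d
  [m%d+n]%d≡[m+n]%d m n = begin
    (m % d + n) % d             ≡⟨ %-distribˡ-+ (m % d) n d ⟩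
    (m % d % d + n % d) % d     ≡⟨ cong (λ t → (t + n % d) % d) (m%n%n≡m%n m d) ⟩
    (m % d + n % d) % d         ≡⟨ sym (%-distribˡ-+ m n d) ⟩
    (m + n) % d                 ∎
    where open ≡-Reasoning

  *%-back-step : ∀ m {r} → r ≤ d → ((suc m * r) % d + (d ∸ r)) % d ≡ (m * r) % d
  *%-back-step m {r} r≤d = begin
    ((suc m * r) % d + (d ∸ r)) % d   ≡⟨ [m%d+n]%d≡[m+n]%d (suc m * r) (d ∸ r) ⟩
    (r + m * r + (d ∸ r)) % d         ≡⟨ cong (_% d) (cong (_+ (d ∸ r)) (+-comm r (m * r))) ⟩
    (m * r + r + (d ∸ r)) % d         ≡⟨ cong (_% d) (+-assoc (m * r) r (d ∸ r)) ⟩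
    (m * r + (r + (d ∸ r))) % d       ≡⟨ cong (λ t → (m * r + t) % d) (m+[n∸m]≡n r≤d) ⟩
    (m * r + d) % d                   ≡⟨ [m+n]%n≡m%n (m * r) d ⟩
    (m * r) % d                       ∎
    where open ≡-Reasoning

  *%-periodic : ∀ a b r → ((a + b * d) * r) % d ≡ (a * r) % d
  *%-periodic a b r = begin
    ((a + b * d) * r) % d       ≡⟨ cong (_% d) (distrib a b d r) ⟩
    (a * r + (b * r) * d) % d   ≡⟨ [m+kn]%n≡m%n (a * r) (b * r) d ⟩
    (a * r) % d                 ∎
    where
    open ≡-Reasoning
    distrib : ∀ a b d r → (a + b * d) * r ≡ a * r + (b * r) * d
    distrib = solve-∀

  InCyclic-*% : ∀ m r → InCyclic d r ((m * r) % d)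
  InCyclic-*% m r = m%n<n (m * r) d , m , (m * r) / d ,
    trans (m≡m%n+[m/n]*n (m * r) d) (+-comm ((m * r) % d) ((m * r) / d * d))

  InCyclic⇒≡*% : ∀ {r x} → InCyclic d r x → ∃[ m ] x ≡ (m * r) % d
  InCyclic⇒≡*% {r} {x} (x<d , m , q , m*r≡q*d+x) = m , (begin
    x                   ≡⟨ sym (m<n⇒m%n≡m x<d) ⟩
    x % d               ≡⟨ sym ([m+kn]%n≡m%n x q d) ⟩
    (x + q * d) % d     ≡⟨ cong (_% d) (trans (+-comm x (q * d)) (sym m*r≡q*d+x)) ⟩
    (m * r) % d         ∎)
    where open ≡-Reasoning

module Entries (B r : ℕ) where
  private
    d : ℕ
    d = half B

  A-diag : ∀ {i} → d ≤ i → i ≤ B → A B r i i ≡ - (+ i)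
  A-diag {i} d≤i i≤B with i ≟ d | i <? d + r
  ... | yes refl | _
    rewrite dec-true (d ≤? d) d≤i | dec-true (d ≤? B) i≤B | dec-true (d ≟ d) refl = refl
  ... | no i≢d | yes i<d+r
    rewrite dec-true (d ≤? i) d≤i | dec-true (i ≤? B) i≤B | dec-false (i ≟ d) i≢d
          | dec-true (i <? d + r) i<d+r | dec-true (i ≟ i) refl = refl
  ... | no i≢d | no i≮d+r
    rewrite dec-true (d ≤? i) d≤i | dec-true (i ≤? B) i≤B | dec-false (i ≟ d) i≢d
          | dec-false (i <? d + r) i≮d+r | dec-true (i ≟ i) refl = refl

  A-top : ∀ {j} → d < j → j ≤ B → j ≡ B + 1 ∸ r → A B r d j ≡ + (2 * j)
  A-top {j} d<j j≤B refl
    rewrite dec-true (d ≤? d) ≤-refl | dec-true (d ≤? B) (≤-trans (<⇒≤ d<j) j≤B)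
          | dec-true (d ≤? j) (<⇒≤ d<j) | dec-true (j ≤? B) j≤B
          | dec-true (d ≟ d) refl | dec-false (j ≟ d) (>⇒≢ d<j) | dec-true (j ≟ j) refl = refl

  A-middle : ∀ {i j} → d < i → i < d + r → i ≤ B → d ≤ j → j ≤ B → j ≢ i → j ≡ d + i ∸ r →
             A B r i j ≡ + j
  A-middle {i} {j} d<i i<d+r i≤B d≤j j≤B j≢i refl
    rewrite dec-true (d ≤? i) (<⇒≤ d<i) | dec-true (i ≤? B) i≤B
          | dec-true (d ≤? j) d≤j | dec-true (j ≤? B) j≤B
          | dec-false (i ≟ d) (>⇒≢ d<i) | dec-true (i <? d + r) i<d+r
          | dec-false (j ≟ i) j≢i | dec-true (j ≟ j) refl = refl

  A-lower : ∀ {i j} → d < i → d + r ≤ i → i ≤ B → d ≤ j → j ≢ i → j ≡ i ∸ r → A B r i j ≡ + j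
  A-lower {i} {j} d<i d+r≤i i≤B d≤j j≢i refl
    rewrite dec-true (d ≤? i) (<⇒≤ d<i) | dec-true (i ≤? B) i≤B
          | dec-true (d ≤? j) d≤j | dec-true (j ≤? B) (≤-trans (m∸n≤m i r) i≤B)
          | dec-false (i ≟ d) (>⇒≢ d<i) | dec-false (i <? d + r) (≤⇒≯ d+r≤i)
          | dec-false (j ≟ i) j≢i | dec-true (j ≟ j) refl = refl

module Connectivity (B r : ℕ) (1+B≡d+d : suc B ≡ half B + half B) (0<r : 0 < r) (r<d : r < half B)
  where
  open Entries B r

  private
    d c : ℕ
    d = half B
    c = d ∸ r

    0<d : 0 < d
    0<d = <-≤-trans 0<r (<⇒≤ r<d)

    instance
      d-nonZero : NonZero d
      d-nonZero = >-nonZero 0<d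

    0<c : 0 < c
    0<c = m<n⇒0<n∸m r<d

    c<d : c < d
    c<d = ∸-monoʳ-< 0<r (<⇒≤ r<d)

    0<d+ : ∀ y → 0 < d + y
    0<d+ y = <-≤-trans 0<d (m≤m+n d y)

  offset<d⇒≤B : ∀ {x} → x < d → d + x ≤ B
  offset<d⇒≤B {x} x<d = s≤s⁻¹ (subst (d + x <_) (sym 1+B≡d+d) (+-monoʳ-< d x<d))

  top-edge : Edge (A B r) (d + 0) (d + c % d)
  top-edge = subst₂ (Edge (A B r)) (sym (+-identityʳ d)) (cong (_+_ d) (sym (m<n⇒m%n≡m c<d)))
    (edge-positive (A B r) (A-top (m<m+n d 0<c) (offset<d⇒≤B c<d) top-column)
                           (<-≤-trans (0<d+ c) (m≤m+n (d + c) _)))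
    where
    top-column : d + c ≡ B + 1 ∸ r
    top-column = sym (trans (cong (_∸ r) (trans (+-comm B 1) 1+B≡d+d)) (+-∸-assoc d (<⇒≤ r<d)))

  middle-edge : ∀ {x} → 0 < x → x < r → Edge (A B r) (d + x) (d + (x + c) % d)
  middle-edge {x} 0<x x<r = subst (Edge (A B r) (d + x)) (cong (_+_ d) (sym (m<n⇒m%n≡m x+c<d)))
    (edge-positive (A B r)
      (A-middle (m<m+n d 0<x) (+-monoʳ-< d x<r) (offset<d⇒≤B (<-trans x<r r<d))
                (m≤m+n d (x + c)) (offset<d⇒≤B x+c<d) j≢i j≡d+i∸r)
      (0<d+ (x + c)))
    where
    open ≡-Reasoning
    x+c<d : x + c < d
    x+c<d = subst (x + c <_) (m+[n∸m]≡n (<⇒≤ r<d)) (+-monoˡ-< c x<r)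
    j≢i : d + (x + c) ≢ d + x
    j≢i eq = <⇒≢ (m<m+n x 0<c) (sym (+-cancelˡ-≡ d (x + c) x eq))
    j≡d+i∸r : d + (x + c) ≡ d + (d + x) ∸ r
    j≡d+i∸r = sym (begin
      d + (d + x) ∸ r     ≡⟨ +-∸-assoc d (≤-trans (<⇒≤ r<d) (m≤m+n d x)) ⟩
      d + ((d + x) ∸ r)   ≡⟨ cong (_+_ d) (+-∸-comm x (<⇒≤ r<d)) ⟩
      d + (c + x)         ≡⟨ cong (_+_ d) (+-comm c x) ⟩
      d + (x + c)         ∎)

  lower-edge : ∀ {x} → r ≤ x → x < d → Edge (A B r) (d + x) (d + (x + c) % d)
  lower-edge {x} r≤x x<d = subst (Edge (A B r) (d + x)) (cong (_+_ d) (sym [x+c]%d≡x∸r))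
    (edge-positive (A B r)
      (A-lower (m<m+n d (<-≤-trans 0<r r≤x)) (+-monoʳ-≤ d r≤x) (offset<d⇒≤B x<d)
               (m≤m+n d (x ∸ r)) j≢i (sym (+-∸-assoc d r≤x)))
      (0<d+ (x ∸ r)))
    where
    open ≡-Reasoning
    j≢i : d + (x ∸ r) ≢ d + x
    j≢i = <⇒≢ (+-monoʳ-< d (∸-monoʳ-< 0<r r≤x))
    [x+c]%d≡x∸r : (x + c) % d ≡ x ∸ r
    [x+c]%d≡x∸r = begin
      (x + c) % d               ≡⟨ cong (λ t → (t + c) % d) (sym (m∸n+n≡m r≤x)) ⟩
      (x ∸ r + r + c) % d       ≡⟨ cong (_% d) (+-assoc (x ∸ r) r c) ⟩
      (x ∸ r + (r + c)) % d     ≡⟨ cong (λ t → (x ∸ r + t) % d) (m+[n∸m]≡n (<⇒≤ r<d)) ⟩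
      (x ∸ r + d) % d           ≡⟨ [m+n]%n≡m%n (x ∸ r) d ⟩
      (x ∸ r) % d               ≡⟨ m<n⇒m%n≡m (≤-<-trans (m∸n≤m x r) x<d) ⟩
      x ∸ r                     ∎

  edge-back : ∀ {x} → x < d → Edge (A B r) (d + x) (d + (x + c) % d)
  edge-back {zero} _ = top-edge
  edge-back {x@(suc _)} x<d with x <? r
  ... | yes x<r = middle-edge z<s x<r
  ... | no x≮r = lower-edge (≮⇒≥ x≮r) x<d

  orbit : ℕ → ℕ
  orbit m = d + (m * r) % d

  orbit-InS : ∀ m → InS B r (orbit m)
  orbit-InS m = m≤m+n d _ , subst (InCyclic d r) (sym (m+n∸m≡n d _)) (InCyclic-*% m r)

  InS⇒orbit : ∀ {i} → InS B r i → ∃[ m ] i ≡ orbit m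
  InS⇒orbit (d≤i , cyc) with m , eq ← InCyclic⇒≡*% cyc =
    m , trans (sym (m+[n∸m]≡n d≤i)) (cong (_+_ d) eq)

  orbit-step : ∀ m → InS B r (orbit m) × Edge (A B r) (orbit (suc m)) (orbit m)
  orbit-step m = orbit-InS m ,
    subst (Edge (A B r) (orbit (suc m))) (cong (_+_ d) (*%-back-step m (<⇒≤ r<d)))
      (edge-back (m%n<n (suc m * r) d))

  diagonal-edge : ∀ {i} → InS B r i → Edge (A B r) i i
  diagonal-edge {i} (d≤i , i∸d<d , _) =
    edge-negative (A B r) (A-diag d≤i i≤B) (<-≤-trans 0<d d≤i)
    where
    i≤B : i ≤ B
    i≤B = subst (_≤ B) (m+[n∸m]≡n d≤i) (offset<d⇒≤B i∸d<d)

  strongly-connected : StronglyConnected (A_S B r)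
  strongly-connected u v with a , u≡a ← InS⇒orbit (proj₂ u) | b , v≡b ← InS⇒orbit (proj₂ v) =
    star-restrict (A B r) diagonal-edge (star-descending orbit orbit-step b≤a+b*d) u v
      (trans u≡a (cong (_+_ d) (sym (*%-periodic a b r)))) v≡b
    where
    b≤a+b*d : b ≤ a + b * d
    b≤a+b*d = ≤-trans (m≤m*n b d) (m≤n+m (b * d) a)

module _ {B : ℕ} (B-odd : B % 2 ≡ 1) where

  odd≡1+2*[/2] : B ≡ suc (B / 2 * 2)
  odd≡1+2*[/2] = trans (m≡m%n+[m/n]*n B 2) (cong (_+ B / 2 * 2) B-odd)

  half-odd : half B ≡ suc (B / 2)
  half-odd = trans (cong (λ t → suc t / 2) odd≡1+2*[/2]) (m*n/n≡m (suc (B / 2)) 2)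

  suc-odd≡half+half : suc B ≡ half B + half B
  suc-odd≡half+half = begin
    suc B                         ≡⟨ cong suc odd≡1+2*[/2] ⟩
    suc (suc (B / 2 * 2))         ≡⟨ double (B / 2) ⟩
    suc (B / 2) + suc (B / 2)     ≡⟨ sym (cong₂ _+_ half-odd half-odd) ⟩
    half B + half B               ∎
    where
    open ≡-Reasoning
    double : ∀ k → suc (suc (k * 2)) ≡ suc k + suc k
    double = solve-∀

  2*r<odd⇒r<half : ∀ {r} → 2 * r < B → r < half B
  2*r<odd⇒r<half {r} 2r<B = subst (r <_) (sym half-odd) (s≤s (*-cancelʳ-≤ r (B / 2) 2 r*2≤[B/2]*2))
    where
    r*2≤[B/2]*2 : r * 2 ≤ B / 2 * 2
    r*2≤[B/2]*2 = s≤s⁻¹ (subst₂ _<_ (*-comm 2 r) odd≡1+2*[/2] 2r<B)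

corollary1 : (B r : ℕ) → 3 ≤ B → B % 2 ≡ 1 → 1 ≤ r → 2 * r < B →
    StronglyConnected (A_S B r)
corollary1 B r _ B-odd 1≤r 2r<B =
  Connectivity.strongly-connected B r (suc-odd≡half+half B-odd) 1≤r (2*r<odd⇒r<half B-odd 2r<B)
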